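{- Let $G$ be a finite vertex-color-avoiding connected graph and let $v$ be a cut-vertex of $G$ (a vertex whose removal disconnects $G$). Then all but one of the connected components of $G-v$ consist only of vertices having the same color as $v$.
   Context: Vertex colorings are arbitrary (not necessarily proper). Two vertices $u,w$ are vertex-$c$-avoiding connected (for a color $c$) if there is a $u$-$w$ path and either at least one of $u,w$ has color $c$ or some $u$-$w$ path contains no vertex of color $c$. A graph is vertex-color-avoiding connected if every two vertices are vertex-$c$-avoiding connected for every color $c$. -}

module Defs where

open import Data.Nat using (ℕ)
open import Data.Fin using (Fin)
open import Data.Product using (Σ; ∃; _×_; _,_)
open import Data.Sum using (_⊎_)
open import Data.Unit using (⊤)
open import Relation.Nullary using (¬_; Dec)
open import Relation.Binary.PropositionalEquality using (_≡_; _≢_)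

record Graph (n : ℕ) : Set₁ where
  field
    Adj    : Fin n → Fin n → Set
    adj?   : (u w : Fin n) → Dec (Adj u w)
    sym    : ∀ {u w} → Adj u w → Adj w u
    irrefl : ∀ {u} → ¬ Adj u u

open Graph public

Coloring : ℕ → Set
Coloring n = Fin n → ℕ

data WalkIn {n : ℕ} (G : Graph n) (P : Fin n → Set) : Fin n → Fin n → Set where
  here  : ∀ {u} → P u → WalkIn G P u u
  there : ∀ {u w x} → P u → Adj G u w → WalkIn G P w x → WalkIn G P u x

Connected : {n : ℕ} → Graph n → Fin n → Fin n → Set
Connected G u w = WalkIn G (λ _ → ⊤) u w

VertexCAvoidingConnected : {n : ℕ} → Graph n → Coloring n → ℕ → Fin n → Fin n → Set
VertexCAvoidingConnected G col c u w =
  Connected G u w ×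
  (col u ≡ c ⊎ col w ≡ c ⊎ WalkIn G (λ x → col x ≢ c) u w)

VertexColorAvoidingConnected : {n : ℕ} → Graph n → Coloring n → Set
VertexColorAvoidingConnected G col =
  ∀ (c : ℕ) (u w : Fin n) → VertexCAvoidingConnected G col c u w
  where n = _

ConnectedWithout : {n : ℕ} → Graph n → Fin n → Fin n → Fin n → Set
ConnectedWithout G v u w = WalkIn G (λ x → x ≢ v) u w

CutVertex : {n : ℕ} → Graph n → Fin n → Set
CutVertex G v = Σ _ λ u → Σ _ λ w → u ≢ v × w ≢ v × ¬ ConnectedWithout G v u w

{-# OPTIONS --safe #-}
module Submission where

open import Defs
open import Data.Nat using (ℕ; _≟_)
open import Data.Fin using (Fin)
open import Data.Fin.Properties using (all?; ¬∀⟶∃¬)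
open import Data.Product using (Σ; _×_; _,_)
open import Data.Sum using (_⊎_; inj₁; inj₂)
open import Data.Empty using (⊥-elim)
open import Relation.Nullary using (¬_; yes; no)
open import Relation.Binary.PropositionalEquality using (_≡_; _≢_; refl)

-- A vertex whose colour differs from that of v is joined, in G − v, to every
-- other such vertex: the col v-avoiding walk between them cannot pass through v.
-- So at most one component of G − v contains vertices of another colour.

WalkIn-map : ∀ {n} {G : Graph n} {P Q : Fin n → Set} → (∀ {x} → P x → Q x) →
             ∀ {u w} → WalkIn G P u w → WalkIn G Q u w
WalkIn-map f (here p)      = here (f p)
WalkIn-map f (there p a w) = there (f p) a (WalkIn-map f w)

avoidingColor⇒connectedWithout : ∀ {n} {G : Graph n} {col : Coloring n} {v u w : Fin n} →
  VertexCAvoidingConnected G col (col v) u w →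
  col u ≢ col v → col w ≢ col v → ConnectedWithout G v u w
avoidingColor⇒connectedWithout (_ , inj₁ cu≡cv)        cu≢cv _     = ⊥-elim (cu≢cv cu≡cv)
avoidingColor⇒connectedWithout (_ , inj₂ (inj₁ cw≡cv)) _     cw≢cv = ⊥-elim (cw≢cv cw≡cv)
avoidingColor⇒connectedWithout (_ , inj₂ (inj₂ walk))  _     _     =
  WalkIn-map (λ { cx≢cv refl → cx≢cv refl }) walk

monochromatic⊎otherColored : ∀ {n} (col : Coloring n) (v : Fin n) →
  ((u : Fin n) → col u ≡ col v) ⊎ Σ (Fin n) λ r → col r ≢ col v
monochromatic⊎otherColored {n} col v with all? (λ u → col u ≟ col v)
... | yes mono = inj₁ mono
... | no ¬mono = inj₂ (¬∀⟶∃¬ n (λ u → col u ≡ col v) (λ u → col u ≟ col v) ¬mono)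

lemma3p12 : (n : ℕ) (G : Graph n) (col : Coloring n) (v : Fin n) →
    VertexColorAvoidingConnected G col → CutVertex G v →
    Σ (Fin n) λ r → r ≢ v ×
    ((u : Fin n) → u ≢ v → ¬ ConnectedWithout G v r u → col u ≡ col v)
lemma3p12 n G col v avoiding (a , _ , a≢v , _) with monochromatic⊎otherColored col v
... | inj₁ mono = a , a≢v , λ u _ _ → mono u
... | inj₂ (r , cr≢cv) = r , (λ { refl → cr≢cv refl }) , sameColor
  where
  sameColor : (u : Fin n) → u ≢ v → ¬ ConnectedWithout G v r u → col u ≡ col v
  sameColor u _ r≁u with col u ≟ col v
  ... | yes cu≡cv = cu≡cv
  ... | no cu≢cv  =
    ⊥-elim (r≁u (avoidingColor⇒connectedWithout (avoiding (col v) r u) cr≢cv cu≢cv))
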